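{- Let $T$ be a string of length $n$, let $1 \le i \le j \le n$ and $1 \le k \le j-i+1$. Let $s_k$ be the $k$-th lexicographically smallest non-empty suffix of $T[i..j]$, and let $S$ be the lexicographically minimal suffix of $T$ such that $k' = \mathit{NotLarger}(T[i..j], S) \ge k$. Then $s_k$ is a prefix of $S$, and there are exactly $k' - k$ prefixes of $S$ longer than $s_k$ which are simultaneously suffixes of $T[i..j]$.
   Context: $T[a..b]$ denotes the substring from position $a$ to $b$ inclusive; suffixes of $T$ are $T[m..n]$ for $1 \le m \le n$. The lexicographic order $\preceq$ is standard: $X \prec Y$ if $X$ is a proper prefix of $Y$ or at the first differing position $X$ has the smaller letter. For strings $X, Y$, $\mathit{NotLarger}(X,Y)$ is the number of non-empty suffixes of $X$ that are $\preceq Y$. -}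

module Defs where

open import Level using (0ℓ)
open import Data.Nat using (ℕ; zero; suc; _+_; _∸_; _≤_; _<_; _<?_)
open import Data.List using (List; []; _∷_; length; take; drop; filter; upTo)
open import Data.Product using (Σ; _×_; _,_)
open import Relation.Binary.Core using (Rel)
open import Relation.Binary.Structures using (IsStrictTotalOrder)
open import Relation.Binary.PropositionalEquality using (_≡_)
open import Relation.Nullary using (Dec)
open import Data.List.Relation.Binary.Lex.Strict using (Lex-≤; Lex-<; ≤-decidable; <-decidable)
open import Data.List.Relation.Binary.Suffix.Heterogeneous using (Suffix)
open import Data.List.Relation.Binary.Suffix.Heterogeneous.Properties using (suffix?)
open import Data.List.Relation.Binary.Prefix.Heterogeneous using (Prefix)

-- Strings over an alphabet A totally ordered by a decidable strict total
-- order _<ₐ_ (w.r.t. propositional equality).  Positions are 1-indexed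
-- as in the paper.
module Str {A : Set} {_<ₐ_ : Rel A 0ℓ} (sto : IsStrictTotalOrder _≡_ _<ₐ_) where

  open IsStrictTotalOrder sto using (_≟_) renaming (_<?_ to _<ₐ?_)

  -- T[a..b] (1-indexed, inclusive)
  substr : List A → ℕ → ℕ → List A
  substr T a b = take (suc b ∸ a) (drop (a ∸ 1) T)

  -- standard lexicographic order ⪯ (a proper prefix is smaller) and its strict part
  _⪯_ : Rel (List A) 0ℓ
  _⪯_ = Lex-≤ _≡_ _<ₐ_

  _≺_ : Rel (List A) 0ℓ
  _≺_ = Lex-< _≡_ _<ₐ_

  _⪯?_ : (X Y : List A) → Dec (X ⪯ Y)
  _⪯?_ = ≤-decidable _≟_ _<ₐ?_

  _≺?_ : (X Y : List A) → Dec (X ≺ Y)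
  _≺?_ = <-decidable _≟_ _<ₐ?_

  IsNonEmptySuffix : List A → List A → Set
  IsNonEmptySuffix s X = Σ ℕ λ m → m < length X × drop m X ≡ s

  NotLarger : List A → List A → ℕ
  NotLarger X Y = length (filter (λ m → drop m X ⪯? Y) (upTo (length X)))

  CountSmaller : List A → List A → ℕ
  CountSmaller X Y = length (filter (λ m → drop m X ≺? Y) (upTo (length X)))

  IsKthSmallestSuffix : List A → ℕ → List A → Set
  IsKthSmallestSuffix X k s = IsNonEmptySuffix s X × suc (CountSmaller X s) ≡ k

  IsMinSuffixWith : List A → (List A → Set) → List A → Set
  IsMinSuffixWith T P S =
    IsNonEmptySuffix S T × P S ×
    (∀ m → m < length T → P (drop m T) → S ⪯ drop m T)

  LongPrefixSuffixCount : ℕ → List A → List A → ℕ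
  LongPrefixSuffixCount L S U =
    length (filter (λ l → suffix? _≟_ (take l S) U)
             (filter (λ l → L <? l) (upTo (suc (length S)))))

-- Let U = T[i..j]. For Y ⪰ sk, the suffixes of U that are ⪯ Y are the k − 1 suffixes
-- smaller than sk, sk itself, and those V with sk ≺ V ⪯ Y; hence NotLarger(U, Y) = k + #{V}
-- and, as S is admissible, sk ⪯ S. A suffix V of U with sk ⪯ V ⪯ S is a prefix of some
-- suffix W of T; sk ⪯ W gives NotLarger(U, W) ≥ k, hence S ⪯ W by minimality, and
-- V ⪯ S ⪯ W with V a prefix of W forces V to be a prefix of S. So sk is a prefix of S, and
-- the suffixes V of U with sk ≺ V ⪯ S are exactly the prefixes of S longer than sk that
-- are suffixes of U; there are NotLarger(U, S) − k of them.
module Submission where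

open import Defs
open import Level using (0ℓ)
open import Function.Base using (id; _∘_)
open import Function.Bundles using (_⇔_; mk⇔; Equivalence)
open import Data.Nat using (ℕ; zero; suc; _+_; _*_; _∸_; _≤_; _<_; _<?_; _≟_; z≤n; s≤s)
open import Data.Nat.Properties
open import Algebra.Properties.CommutativeSemigroup +-commutativeSemigroup using (interchange)
open import Data.Bool using (if_then_else_)
open import Data.List using (List; []; _∷_; length; take; drop; filter; upTo; applyUpTo)
open import Data.List.Properties using (length-take; length-drop)
open import Data.Product using (∃-syntax; _×_; _,_; proj₁; proj₂)
open import Data.Sum using (_⊎_; inj₁; inj₂)
open import Relation.Nullary using (Dec; yes; no; does; ¬_; contradiction)
open import Relation.Nullary.Decidable using (_×-dec_)
open import Relation.Unary using (Pred; Decidable)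
open import Relation.Unary.Properties using (_∩?_)
open import Relation.Binary.Core using (Rel)
open import Relation.Binary.Structures using (IsStrictTotalOrder)
open import Relation.Binary.PropositionalEquality
  using (_≡_; refl; sym; trans; cong; cong₂; subst; module ≡-Reasoning)
open import Relation.Binary.Definitions using (tri<; tri≈; tri>)
import Data.List.Relation.Binary.Pointwise as Pointwise
import Data.List.Relation.Binary.Lex.Strict as Lex
open import Data.List.Relation.Binary.Lex.Core using (base; halt; this; next)
open import Data.List.Relation.Binary.Pointwise using (Pointwise-≡⇒≡)
open import Data.List.Relation.Binary.Prefix.Heterogeneous using (Prefix; []; _∷_)
import Data.List.Relation.Binary.Prefix.Heterogeneous.Properties as Prefix
open import Data.List.Relation.Binary.Prefix.Heterogeneous.Properties using (drop⁺)
open import Data.List.Relation.Binary.Suffix.Heterogeneous using (Suffix; here; there)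
import Data.List.Relation.Binary.Suffix.Heterogeneous.Properties as Suffix
open import Data.List.Relation.Binary.Suffix.Heterogeneous.Properties using (suffix?)
open import Data.List.Relation.Binary.Infix.Heterogeneous using (Infix; here; there)

𝟙 : ∀ {p} {P : Set p} → Dec P → ℕ
𝟙 P? = if does P? then 1 else 0

𝟙-yes : ∀ {p} {P : Set p} (P? : Dec P) → P → 𝟙 P? ≡ 1
𝟙-yes (yes _) _ = refl
𝟙-yes (no ¬p) p = contradiction p ¬p

𝟙-no : ∀ {p} {P : Set p} (P? : Dec P) → ¬ P → 𝟙 P? ≡ 0
𝟙-no (yes p) ¬p = contradiction p ¬p
𝟙-no (no _)  _  = refl

𝟙-cong : ∀ {p q} {P : Set p} {Q : Set q} (P? : Dec P) (Q? : Dec Q) → P ⇔ Q → 𝟙 P? ≡ 𝟙 Q?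
𝟙-cong (yes p) Q? P⇔Q = sym (𝟙-yes Q? (Equivalence.to P⇔Q p))
𝟙-cong (no ¬p) Q? P⇔Q = sym (𝟙-no Q? (¬p ∘ Equivalence.from P⇔Q))

𝟙-× : ∀ {p q} {P : Set p} {Q : Set q} (P? : Dec P) (Q? : Dec Q) → 𝟙 P? * 𝟙 Q? ≡ 𝟙 (P? ×-dec Q?)
𝟙-× (yes _) (yes _) = refl
𝟙-× (yes _) (no _)  = refl
𝟙-× (no _)  _       = refl

∑< : ℕ → (ℕ → ℕ) → ℕ
∑< zero    f = 0
∑< (suc n) f = f 0 + ∑< n (f ∘ suc)

syntax ∑< n (λ x → e) = ∑[ x < n ] e

∑-cong : ∀ n {f g : ℕ → ℕ} → (∀ x → x < n → f x ≡ g x) → ∑< n f ≡ ∑< n g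
∑-cong zero    f≡g = refl
∑-cong (suc n) f≡g = cong₂ _+_ (f≡g 0 (s≤s z≤n)) (∑-cong n (λ x x<n → f≡g (suc x) (s≤s x<n)))

∑-mono-≤ : ∀ n {f g : ℕ → ℕ} → (∀ x → x < n → f x ≤ g x) → ∑< n f ≤ ∑< n g
∑-mono-≤ zero    f≤g = z≤n
∑-mono-≤ (suc n) f≤g = +-mono-≤ (f≤g 0 (s≤s z≤n)) (∑-mono-≤ n (λ x x<n → f≤g (suc x) (s≤s x<n)))

∑-zero : ∀ n {f : ℕ → ℕ} → (∀ x → x < n → f x ≡ 0) → ∑< n f ≡ 0
∑-zero zero    f≡0 = refl
∑-zero (suc n) f≡0 = cong₂ _+_ (f≡0 0 (s≤s z≤n)) (∑-zero n (λ x x<n → f≡0 (suc x) (s≤s x<n)))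

∑-distrib-+ : ∀ n (f g : ℕ → ℕ) → ∑[ x < n ] (f x + g x) ≡ ∑< n f + ∑< n g
∑-distrib-+ zero    f g = refl
∑-distrib-+ (suc n) f g =
  trans (cong (f 0 + g 0 +_) (∑-distrib-+ n (f ∘ suc) (g ∘ suc))) (interchange (f 0) (g 0) _ _)

∑-snoc : ∀ n (f : ℕ → ℕ) → ∑< (suc n) f ≡ ∑< n f + f n
∑-snoc zero    f = +-comm (f 0) 0
∑-snoc (suc n) f = trans (cong (f 0 +_) (∑-snoc n (f ∘ suc))) (sym (+-assoc (f 0) _ _))

∑-reverse : ∀ n (f : ℕ → ℕ) → ∑< n f ≡ ∑[ x < n ] f (n ∸ suc x)
∑-reverse zero    f = refl
∑-reverse (suc n) f = begin
  ∑< (suc n) f                    ≡⟨ ∑-snoc n f ⟩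
  ∑< n f + f n                    ≡⟨ cong (_+ f n) (∑-reverse n f) ⟩
  ∑[ x < n ] f (n ∸ suc x) + f n  ≡⟨ +-comm _ (f n) ⟩
  f n + ∑[ x < n ] f (n ∸ suc x)  ∎
  where open ≡-Reasoning

∑-split : ∀ n d (f : ℕ → ℕ) → ∑< (n + d) f ≡ ∑< n f + ∑[ x < d ] f (n + x)
∑-split zero    d f = refl
∑-split (suc n) d f = trans (cong (f 0 +_) (∑-split n d (f ∘ suc))) (sym (+-assoc (f 0) _ _))

∑-restrict : ∀ n d (f : ℕ → ℕ) → ∑[ x < n + d ] (𝟙 (x <? n) * f x) ≡ ∑< n f
∑-restrict n d f = begin
  ∑[ x < n + d ] (𝟙 (x <? n) * f x)                                    ≡⟨ ∑-split n d _ ⟩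
  ∑[ x < n ] (𝟙 (x <? n) * f x) + ∑[ x < d ] (𝟙 (n + x <? n) * f (n + x)) ≡⟨ cong₂ _+_ inside outside ⟩
  ∑< n f + 0                                                            ≡⟨ +-identityʳ _ ⟩
  ∑< n f                                                                ∎
  where
  open ≡-Reasoning
  inside : ∑[ x < n ] (𝟙 (x <? n) * f x) ≡ ∑< n f
  inside = ∑-cong n (λ x x<n → trans (cong (_* f x) (𝟙-yes (x <? n) x<n)) (*-identityˡ (f x)))
  outside : ∑[ x < d ] (𝟙 (n + x <? n) * f (n + x)) ≡ 0
  outside = ∑-zero d (λ x _ → cong (_* f (n + x)) (𝟙-no (n + x <? n) (m+n≮m n x)))

∑-𝟙-≟ : ∀ {n m₀} → m₀ < n → ∑[ m < n ] 𝟙 (m ≟ m₀) ≡ 1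
∑-𝟙-≟ {suc n} {zero}   _          = cong suc (∑-zero n (λ _ _ → refl))
∑-𝟙-≟ {suc n} {suc m₀} (s≤s m₀<n) = ∑-𝟙-≟ m₀<n

∑-𝟙-cong-bounded : ∀ {p q} {P : Pred ℕ p} {Q : Pred ℕ q} (P? : Decidable P) (Q? : Decidable Q) {a b} →
                   (∀ x → (x < a × P x) ⇔ (x < b × Q x)) →
                   ∑[ x < a ] 𝟙 (P? x) ≡ ∑[ x < b ] 𝟙 (Q? x)
∑-𝟙-cong-bounded P? Q? {a} {b} P⇔Q = begin
  ∑[ x < a ] 𝟙 (P? x)                       ≡⟨ ∑-restrict a b _ ⟨
  ∑[ x < a + b ] (𝟙 (x <? a) * 𝟙 (P? x))    ≡⟨ ∑-cong (a + b) (λ x _ → on-a+b x) ⟩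
  ∑[ x < a + b ] (𝟙 (x <? b) * 𝟙 (Q? x))    ≡⟨ cong (λ n → ∑[ x < n ] (𝟙 (x <? b) * 𝟙 (Q? x))) (+-comm a b) ⟩
  ∑[ x < b + a ] (𝟙 (x <? b) * 𝟙 (Q? x))    ≡⟨ ∑-restrict b a _ ⟩
  ∑[ x < b ] 𝟙 (Q? x)                       ∎
  where
  open ≡-Reasoning
  on-a+b : ∀ x → 𝟙 (x <? a) * 𝟙 (P? x) ≡ 𝟙 (x <? b) * 𝟙 (Q? x)
  on-a+b x = trans (𝟙-× (x <? a) (P? x))
    (trans (𝟙-cong ((x <? a) ×-dec P? x) ((x <? b) ×-dec Q? x) (P⇔Q x)) (sym (𝟙-× (x <? b) (Q? x))))

length-filter-applyUpTo : ∀ {p} {P : Pred ℕ p} (P? : Decidable P) (f : ℕ → ℕ) n →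
                          length (filter P? (applyUpTo f n)) ≡ ∑[ x < n ] 𝟙 (P? (f x))
length-filter-applyUpTo P? f zero = refl
length-filter-applyUpTo P? f (suc n) with P? (f 0)
... | yes _ = cong suc (length-filter-applyUpTo P? (f ∘ suc) n)
... | no  _ = length-filter-applyUpTo P? (f ∘ suc) n

filter-filter : ∀ {a p q} {A : Set a} {P : Pred A p} {Q : Pred A q} (P? : Decidable P) (Q? : Decidable Q)
                (xs : List A) → filter Q? (filter P? xs) ≡ filter (P? ∩? Q?) xs
filter-filter P? Q? [] = refl
filter-filter P? Q? (x ∷ xs) with P? x
... | no _ = filter-filter P? Q? xs
... | yes _ with Q? x
...   | yes _ = cong (x ∷_) (filter-filter P? Q? xs)
...   | no  _ = filter-filter P? Q? xs

module _ {a} {A : Set a} where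

  take-prefix : ∀ n (xs : List A) → Prefix _≡_ (take n xs) xs
  take-prefix zero    xs       = []
  take-prefix (suc n) []       = []
  take-prefix (suc n) (x ∷ xs) = refl ∷ take-prefix n xs

  drop-suffix : ∀ n (xs : List A) → Suffix _≡_ (drop n xs) xs
  drop-suffix zero    xs       = here (Pointwise.refl refl)
  drop-suffix (suc n) []       = here (Pointwise.refl refl)
  drop-suffix (suc n) (x ∷ xs) = there (drop-suffix n xs)

  prefix⇒take-length : ∀ {V S : List A} → Prefix _≡_ V S → take (length V) S ≡ V
  prefix⇒take-length []           = refl
  prefix⇒take-length (refl ∷ V⊑S) = cong (_ ∷_) (prefix⇒take-length V⊑S)

  suffix⇒drop-length : ∀ {V U : List A} → Suffix _≡_ V U → drop (length U ∸ length V) U ≡ V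
  suffix⇒drop-length {V} (here V≋U) with refl ← Pointwise-≡⇒≡ V≋U = cong (λ n → drop n V) (n∸n≡0 (length V))
  suffix⇒drop-length {V} {u ∷ U} (there V⊒U) = begin
    drop (suc (length U) ∸ length V) (u ∷ U) ≡⟨ cong (λ n → drop n (u ∷ U)) (+-∸-assoc 1 (Suffix.length-mono V⊒U)) ⟩
    drop (length U ∸ length V) U             ≡⟨ suffix⇒drop-length V⊒U ⟩
    V                                        ∎
    where open ≡-Reasoning

  infix-suffix-prefix : ∀ {U T : List A} → Infix _≡_ U T → ∀ {m} → m < length U →
                        ∃[ p ] p < length T × Prefix _≡_ (drop m U) (drop p T)
  infix-suffix-prefix (here U⊑T) {m} m<∣U∣ = m , <-≤-trans m<∣U∣ (Prefix.length-mono U⊑T) , drop⁺ m U⊑T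
  infix-suffix-prefix (there U⊆T) m<∣U∣ with p , p<∣T∣ , U[m]⊑T[p] ← infix-suffix-prefix U⊆T m<∣U∣ =
    suc p , s≤s p<∣T∣ , U[m]⊑T[p]

  take-drop-infix : ∀ (T : List A) m n → Infix _≡_ (take n (drop m T)) T
  take-drop-infix T        zero    n = here (take-prefix n T)
  take-drop-infix []       (suc m) n = here (take-prefix n [])
  take-drop-infix (x ∷ T)  (suc m) n = there (take-drop-infix T m n)

module _ {A : Set} {_<ₐ_ : Rel A 0ℓ} (sto : IsStrictTotalOrder _≡_ _<ₐ_) where

  open Str sto
  open IsStrictTotalOrder sto using (isEquivalence; <-resp-≈; irrefl) renaming (_≟_ to _≟ₐ_; trans to <ₐ-trans)
  private module LexSTO = IsStrictTotalOrder (Lex.<-isStrictTotalOrder sto)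

  ≺⇒⪯ : ∀ {X Y} → X ≺ Y → X ⪯ Y
  ≺⇒⪯ (base ())
  ≺⇒⪯ halt         = halt
  ≺⇒⪯ (this x<y)   = this x<y
  ≺⇒⪯ (next x≡y p) = next x≡y (≺⇒⪯ p)

  ⪯⇒≺⊎≡ : ∀ {X Y} → X ⪯ Y → X ≺ Y ⊎ X ≡ Y
  ⪯⇒≺⊎≡ (base _)        = inj₂ refl
  ⪯⇒≺⊎≡ halt            = inj₁ halt
  ⪯⇒≺⊎≡ (this x<y)      = inj₁ (this x<y)
  ⪯⇒≺⊎≡ (next refl X⪯Y) with ⪯⇒≺⊎≡ X⪯Y
  ... | inj₁ X≺Y  = inj₁ (next refl X≺Y)
  ... | inj₂ refl = inj₂ refl

  ⪯-refl : ∀ X → X ⪯ X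
  ⪯-refl X = Lex.≤-reflexive _≡_ _<ₐ_ (Pointwise.refl refl)

  ⪯-trans : ∀ {X Y Z} → X ⪯ Y → Y ⪯ Z → X ⪯ Z
  ⪯-trans = Lex.≤-transitive isEquivalence <-resp-≈ <ₐ-trans

  ≺-trans : ∀ {X Y Z} → X ≺ Y → Y ≺ Z → X ≺ Z
  ≺-trans = LexSTO.trans

  ≺-irrefl : ∀ {X} → ¬ X ≺ X
  ≺-irrefl = LexSTO.irrefl (Pointwise.refl refl)

  ⪯-≺-trans : ∀ {X Y Z} → X ⪯ Y → Y ≺ Z → X ≺ Z
  ⪯-≺-trans X⪯Y Y≺Z with ⪯⇒≺⊎≡ X⪯Y
  ... | inj₁ X≺Y  = ≺-trans X≺Y Y≺Z
  ... | inj₂ refl = Y≺Z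

  ≺-trichotomy : ∀ X Y → X ≺ Y ⊎ X ≡ Y ⊎ Y ≺ X
  ≺-trichotomy X Y with LexSTO.compare X Y
  ... | tri< X≺Y _ _ = inj₁ X≺Y
  ... | tri≈ _ X≋Y _ = inj₂ (inj₁ (Pointwise-≡⇒≡ X≋Y))
  ... | tri> _ _ Y≺X = inj₂ (inj₂ Y≺X)

  Prefix⇒⪯ : ∀ {V W} → Prefix _≡_ V W → V ⪯ W
  Prefix⇒⪯ {W = []}    []           = base _
  Prefix⇒⪯ {W = _ ∷ _} []           = halt
  Prefix⇒⪯             (refl ∷ V⊑W) = next refl (Prefix⇒⪯ V⊑W)

  prefix-squeeze : ∀ {V S W} → V ⪯ S → S ⪯ W → Prefix _≡_ V W → Prefix _≡_ V S
  prefix-squeeze _                  _                  []           = []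
  prefix-squeeze (this v<s)         (this s<v)         (refl ∷ _)   = contradiction (<ₐ-trans v<s s<v) (irrefl refl)
  prefix-squeeze (this v<v)         (next refl _)      (refl ∷ _)   = contradiction v<v (irrefl refl)
  prefix-squeeze (next refl _)      (this v<v)         (refl ∷ _)   = contradiction v<v (irrefl refl)
  prefix-squeeze (next refl V⪯S)    (next refl S⪯W)    (refl ∷ V⊑W) = refl ∷ prefix-squeeze V⪯S S⪯W V⊑W

  prefix-length-<⇒≺ : ∀ {V W S} → Prefix _≡_ V S → Prefix _≡_ W S → length V < length W → V ≺ W
  prefix-length-<⇒≺ []           (_ ∷ _)      _           = halt
  prefix-length-<⇒≺ (refl ∷ V⊑S) (refl ∷ W⊑S) (s≤s ∣V∣<∣W∣) = next refl (prefix-length-<⇒≺ V⊑S W⊑S ∣V∣<∣W∣)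

  prefix-≺⇒length-< : ∀ {V W S} → Prefix _≡_ V S → Prefix _≡_ W S → V ≺ W → length V < length W
  prefix-≺⇒length-< []           (_ ∷ _)      _          = s≤s z≤n
  prefix-≺⇒length-< []           []           V≺W        = contradiction V≺W ≺-irrefl
  prefix-≺⇒length-< (refl ∷ _)   (refl ∷ _)   (this v<v) = contradiction v<v (irrefl refl)
  prefix-≺⇒length-< (refl ∷ V⊑S) (refl ∷ W⊑S) (next _ V≺W) = s≤s (prefix-≺⇒length-< V⊑S W⊑S V≺W)

  notLarger-≤-countSmaller : ∀ X {Y Z} → Y ≺ Z → NotLarger X Y ≤ CountSmaller X Z
  notLarger-≤-countSmaller X {Y} {Z} Y≺Z = begin
    NotLarger X Y                                 ≡⟨ length-filter-applyUpTo _ id (length X) ⟩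
    ∑[ m < length X ] 𝟙 (drop m X ⪯? Y)          ≤⟨ ∑-mono-≤ (length X) (λ m _ → 𝟙-mono m) ⟩
    ∑[ m < length X ] 𝟙 (drop m X ≺? Z)          ≡⟨ length-filter-applyUpTo _ id (length X) ⟨
    CountSmaller X Z                              ∎
    where
    open ≤-Reasoning
    𝟙-mono : ∀ m → 𝟙 (drop m X ⪯? Y) ≤ 𝟙 (drop m X ≺? Z)
    𝟙-mono m with drop m X ⪯? Y
    ... | yes X[m]⪯Y = ≤-reflexive (sym (𝟙-yes (drop m X ≺? Z) (⪯-≺-trans X[m]⪯Y Y≺Z)))
    ... | no  _      = z≤n

  module KthSmallestSuffix {T U : List A} (U⊆T : Infix _≡_ U T) {k : ℕ} {sk S : List A}
    (sk-kth : IsKthSmallestSuffix U k sk)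
    (S-min : IsMinSuffixWith T (λ X → k ≤ NotLarger U X) S) where

    private
      u : ℕ
      u = length U
      m₀ : ℕ
      m₀ = proj₁ (proj₁ sk-kth)
      m₀<u : m₀ < u
      m₀<u = proj₁ (proj₂ (proj₁ sk-kth))
      U[m₀]≡sk : drop m₀ U ≡ sk
      U[m₀]≡sk = proj₂ (proj₂ (proj₁ sk-kth))
      1+#≺sk≡k : suc (CountSmaller U sk) ≡ k
      1+#≺sk≡k = proj₂ sk-kth

    Between : List A → ℕ → Set
    Between Y m = sk ≺ drop m U × drop m U ⪯ Y

    between? : ∀ Y m → Dec (Between Y m)
    between? Y m = (sk ≺? drop m U) ×-dec (drop m U ⪯? Y)

    #between : List A → ℕ
    #between Y = ∑[ m < u ] 𝟙 (between? Y m)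

    suffix-≡sk⇒≡m₀ : ∀ {m} → m < u → drop m U ≡ sk → m ≡ m₀
    suffix-≡sk⇒≡m₀ {m} m<u U[m]≡sk = ∸-cancelˡ-≡ (<⇒≤ m<u) (<⇒≤ m₀<u) (begin
      u ∸ m              ≡⟨ length-drop m U ⟨
      length (drop m U)  ≡⟨ cong length (trans U[m]≡sk (sym U[m₀]≡sk)) ⟩
      length (drop m₀ U) ≡⟨ length-drop m₀ U ⟩
      u ∸ m₀             ∎)
      where open ≡-Reasoning

    𝟙-⪯-split : ∀ {Y} → sk ⪯ Y → ∀ {m} → m < u →
                𝟙 (drop m U ⪯? Y) ≡ 𝟙 (drop m U ≺? sk) + (𝟙 (m ≟ m₀) + 𝟙 (between? Y m))
    𝟙-⪯-split {Y} sk⪯Y {m} m<u with ≺-trichotomy (drop m U) sk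
    ... | inj₁ U[m]≺sk = begin
      𝟙 (drop m U ⪯? Y)  ≡⟨ 𝟙-yes (drop m U ⪯? Y) (⪯-trans (≺⇒⪯ U[m]≺sk) sk⪯Y) ⟩
      1 + (0 + 0)        ≡⟨ cong₂ _+_ (𝟙-yes (drop m U ≺? sk) U[m]≺sk) (cong₂ _+_
                              (𝟙-no (m ≟ m₀) λ { refl → ≺-irrefl (subst (_≺ sk) U[m₀]≡sk U[m]≺sk) })
                              (𝟙-no (between? Y m) λ (sk≺U[m] , _) → ≺-irrefl (≺-trans U[m]≺sk sk≺U[m]))) ⟨
      _                  ∎
      where open ≡-Reasoning
    ... | inj₂ (inj₁ U[m]≡sk) = begin
      𝟙 (drop m U ⪯? Y)  ≡⟨ 𝟙-yes (drop m U ⪯? Y) (subst (_⪯ Y) (sym U[m]≡sk) sk⪯Y) ⟩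
      0 + (1 + 0)        ≡⟨ cong₂ _+_ (𝟙-no (drop m U ≺? sk) (≺-irrefl ∘ subst (_≺ sk) U[m]≡sk)) (cong₂ _+_
                              (𝟙-yes (m ≟ m₀) (suffix-≡sk⇒≡m₀ m<u U[m]≡sk))
                              (𝟙-no (between? Y m) (≺-irrefl ∘ subst (sk ≺_) U[m]≡sk ∘ proj₁))) ⟨
      _                  ∎
      where open ≡-Reasoning
    ... | inj₂ (inj₂ sk≺U[m]) = begin
      𝟙 (drop m U ⪯? Y)         ≡⟨ 𝟙-cong (drop m U ⪯? Y) (between? Y m) (mk⇔ (sk≺U[m] ,_) proj₂) ⟩
      0 + (0 + 𝟙 (between? Y m)) ≡⟨ cong₂ _+_ (𝟙-no (drop m U ≺? sk) (≺-irrefl ∘ ≺-trans sk≺U[m])) (cong (_+ _)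
                                     (𝟙-no (m ≟ m₀) λ { refl → ≺-irrefl (subst (sk ≺_) U[m₀]≡sk sk≺U[m]) })) ⟨
      _                         ∎
      where open ≡-Reasoning

    notLarger≡k+#between : ∀ {Y} → sk ⪯ Y → NotLarger U Y ≡ k + #between Y
    notLarger≡k+#between {Y} sk⪯Y = begin
      NotLarger U Y
        ≡⟨ length-filter-applyUpTo _ id u ⟩
      ∑[ m < u ] 𝟙 (drop m U ⪯? Y)
        ≡⟨ ∑-cong u (λ m m<u → 𝟙-⪯-split sk⪯Y m<u) ⟩
      ∑[ m < u ] (𝟙 (drop m U ≺? sk) + (𝟙 (m ≟ m₀) + 𝟙 (between? Y m)))
        ≡⟨ ∑-distrib-+ u _ _ ⟩
      ∑[ m < u ] 𝟙 (drop m U ≺? sk) + ∑[ m < u ] (𝟙 (m ≟ m₀) + 𝟙 (between? Y m))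
        ≡⟨ cong₂ _+_ (sym (length-filter-applyUpTo _ id u)) (∑-distrib-+ u _ _) ⟩
      CountSmaller U sk + (∑[ m < u ] 𝟙 (m ≟ m₀) + #between Y)
        ≡⟨ cong (λ n → CountSmaller U sk + (n + #between Y)) (∑-𝟙-≟ m₀<u) ⟩
      CountSmaller U sk + suc (#between Y)
        ≡⟨ +-suc _ _ ⟩
      suc (CountSmaller U sk) + #between Y
        ≡⟨ cong (_+ #between Y) 1+#≺sk≡k ⟩
      k + #between Y
        ∎
      where open ≡-Reasoning

    k≤notLarger : ∀ {Y} → sk ⪯ Y → k ≤ NotLarger U Y
    k≤notLarger {Y} sk⪯Y = subst (k ≤_) (sym (notLarger≡k+#between sk⪯Y)) (m≤m+n k (#between Y))

    sk⪯S : sk ⪯ S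
    sk⪯S with ≺-trichotomy sk S
    ... | inj₁ sk≺S        = ≺⇒⪯ sk≺S
    ... | inj₂ (inj₁ refl) = ⪯-refl sk
    ... | inj₂ (inj₂ S≺sk) = contradiction
      (subst (_≤ CountSmaller U sk) (sym 1+#≺sk≡k) (≤-trans (proj₁ (proj₂ S-min)) (notLarger-≤-countSmaller U S≺sk)))
      (n≮n _)

    squeezed-suffix-prefix : ∀ {m} → m < u → sk ⪯ drop m U → drop m U ⪯ S → Prefix _≡_ (drop m U) S
    squeezed-suffix-prefix m<u sk⪯U[m] U[m]⪯S
      with p , p<∣T∣ , U[m]⊑T[p] ← infix-suffix-prefix U⊆T m<u =
      prefix-squeeze U[m]⪯S S⪯T[p] U[m]⊑T[p]
      where
      S⪯T[p] : S ⪯ drop p T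
      S⪯T[p] = proj₂ (proj₂ S-min) p p<∣T∣ (k≤notLarger (⪯-trans sk⪯U[m] (Prefix⇒⪯ U[m]⊑T[p])))

    sk⊑S : Prefix _≡_ sk S
    sk⊑S = subst (λ V → Prefix _≡_ V S) U[m₀]≡sk
      (squeezed-suffix-prefix m₀<u (subst (sk ⪯_) (sym U[m₀]≡sk) (⪯-refl sk)) (subst (_⪯ S) (sym U[m₀]≡sk) sk⪯S))

    between⇔long-prefix : ∀ {m} → m < u →
                          Between S m ⇔ (Prefix _≡_ (drop m U) S × length sk < length (drop m U))
    between⇔long-prefix m<u = mk⇔
      (λ (sk≺V , V⪯S) → let V⊑S = squeezed-suffix-prefix m<u (≺⇒⪯ sk≺V) V⪯S in
                        V⊑S , prefix-≺⇒length-< sk⊑S V⊑S sk≺V)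
      (λ (V⊑S , ∣sk∣<∣V∣) → prefix-length-<⇒≺ sk⊑S V⊑S ∣sk∣<∣V∣ , Prefix⇒⪯ V⊑S)

    LongPrefixSuffix : ℕ → Set
    LongPrefixSuffix l = length sk < l × Suffix _≡_ (take l S) U

    longPrefixSuffix? : ∀ l → Dec (LongPrefixSuffix l)
    longPrefixSuffix? l = (length sk <? l) ×-dec suffix? _≟ₐ_ (take l S) U

    -- A suffix of U of length 1 + x is drop (u ∸ suc x) U, a prefix of S of that length is take (suc x) S.
    between⇔longPrefixSuffix : ∀ x → (x < u × Between S (u ∸ suc x)) ⇔ (x < length S × LongPrefixSuffix (suc x))
    between⇔longPrefixSuffix x = mk⇔ to from
      where
      to : x < u × Between S (u ∸ suc x) → x < length S × LongPrefixSuffix (suc x)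
      to (x<u , between)
        with V⊑S , ∣sk∣<∣V∣ ← Equivalence.to (between⇔long-prefix (∸-monoʳ-< (s≤s z≤n) x<u)) between =
        subst (_≤ length S) ∣V∣≡1+x (Prefix.length-mono V⊑S) ,
        subst (length sk <_) ∣V∣≡1+x ∣sk∣<∣V∣ ,
        subst (λ W → Suffix _≡_ W U) (sym S[<1+x]≡V) (drop-suffix (u ∸ suc x) U)
        where
        V = drop (u ∸ suc x) U
        ∣V∣≡1+x : length V ≡ suc x
        ∣V∣≡1+x = trans (length-drop (u ∸ suc x) U) (m∸[m∸n]≡n x<u)
        S[<1+x]≡V : take (suc x) S ≡ V
        S[<1+x]≡V = subst (λ n → take n S ≡ V) ∣V∣≡1+x (prefix⇒take-length V⊑S)
      from : x < length S × LongPrefixSuffix (suc x) → x < u × Between S (u ∸ suc x)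
      from (x<∣S∣ , ∣sk∣<1+x , W⊒U) =
        x<u , Equivalence.from (between⇔long-prefix (∸-monoʳ-< (s≤s z≤n) x<u))
                (subst (λ V → Prefix _≡_ V S) (sym V≡W) (take-prefix (suc x) S) ,
                 subst (length sk <_) (sym (trans (cong length V≡W) ∣W∣≡1+x)) ∣sk∣<1+x)
        where
        W = take (suc x) S
        ∣W∣≡1+x : length W ≡ suc x
        ∣W∣≡1+x = trans (length-take (suc x) S) (m≤n⇒m⊓n≡m x<∣S∣)
        x<u : x < u
        x<u = subst (_≤ u) ∣W∣≡1+x (Suffix.length-mono W⊒U)
        V≡W : drop (u ∸ suc x) U ≡ W
        V≡W = subst (λ n → drop (u ∸ n) U ≡ W) ∣W∣≡1+x (suffix⇒drop-length W⊒U)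

    longPrefixSuffixCount≡#between : LongPrefixSuffixCount (length sk) S U ≡ #between S
    longPrefixSuffixCount≡#between = begin
      LongPrefixSuffixCount (length sk) S U
        ≡⟨ cong length (filter-filter (length sk <?_) (λ l → suffix? _≟ₐ_ (take l S) U) (upTo (suc (length S)))) ⟩
      length (filter longPrefixSuffix? (upTo (suc (length S))))
        -- the summand for l = 0 vanishes definitionally, as length sk <? 0 reduces to no
        ≡⟨ length-filter-applyUpTo longPrefixSuffix? id (suc (length S)) ⟩
      ∑[ x < length S ] 𝟙 (longPrefixSuffix? (suc x))
        ≡⟨ ∑-𝟙-cong-bounded (λ x → between? S (u ∸ suc x)) (longPrefixSuffix? ∘ suc) between⇔longPrefixSuffix ⟨
      ∑[ x < u ] 𝟙 (between? S (u ∸ suc x))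
        ≡⟨ ∑-reverse u _ ⟨
      #between S
        ∎
      where open ≡-Reasoning

fact3 : {A : Set} {_<ₐ_ : Rel A 0ℓ} (sto : IsStrictTotalOrder _≡_ _<ₐ_)
        (T : List A) (i j k : ℕ) →
        1 ≤ i → i ≤ j → j ≤ length T →
        1 ≤ k → k ≤ j ∸ i + 1 →
        (sk S : List A) →
        Str.IsKthSmallestSuffix sto (Str.substr sto T i j) k sk →
        Str.IsMinSuffixWith sto T (λ X → k ≤ Str.NotLarger sto (Str.substr sto T i j) X) S →
        Prefix _≡_ sk S
        × Str.LongPrefixSuffixCount sto (length sk) S (Str.substr sto T i j)
          ≡ Str.NotLarger sto (Str.substr sto T i j) S ∸ k
fact3 {A} sto T i j k _ _ _ _ _ sk S sk-kth S-min = sk⊑S , (begin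
  LongPrefixSuffixCount (length sk) S U  ≡⟨ longPrefixSuffixCount≡#between ⟩
  #between S                             ≡⟨ m+n∸m≡n k (#between S) ⟨
  k + #between S ∸ k                     ≡⟨ cong (_∸ k) (notLarger≡k+#between sk⪯S) ⟨
  NotLarger U S ∸ k                      ∎)
  where
  open Str sto
  U : List A
  U = substr T i j
  open KthSmallestSuffix sto (take-drop-infix T (i ∸ 1) (suc j ∸ i)) sk-kth S-min
  open ≡-Reasoning
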